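{- With the notation of the context (Algorithm 1 applied to $s$), for every integer $k$ with $3\le k\le m$: (i) if $z_{k+1,k-1}=2a_{k-1}+1$, then $z_{k+1,k-2}=0$; (ii) if $z_{k+1,k-1}=2a_{k-1}$, then $z_{k+1,k-2}\le a_{k-2}$.
   Context: Let $a$ be a real number with infinite continued fraction expansion $[a_0;a_1,a_2,\dots]$ ($a_0\in\mathbb{Z}$, $a_i$ positive integers for $i\ge1$). Set $q_{ -1}=0$, $q_0=1$, $q_{k+1}=a_{k+1}q_k+q_{k-1}$. The Ostrowski representation of $N\in\mathbb{N}$ is the unique word $b_n\dots b_1$ with $N=\sum_{k=0}^{n}b_{k+1}q_k$, $b_k\in\mathbb{N}$, $b_1<a_1$, $b_k\le a_k$, and $b_{k-1}=0$ whenever $b_k=a_k$. A word is written $u_r\dots u_1$; $u_i$ is the entry at position $i$. Let $M,N\in\mathbb{N}$ have Ostrowski representations $x_n\dots x_1$ and $y_n\dots y_1$ (padded with leading zeros to a common length $n$). Let $m=n+1$, $s_i=x_i+y_i$ for $1\le i\le n$, $s_m=0$, and $s=s_m\dots s_1$. Algorithm 1 defines words $z_k=z_{k,m}\dots z_{k,1}$ for $k=m+1,m,\dots,3$ recursively (in decreasing $k$). Put $z_{m+1}=s$. For $4\le k\le m$: $z_{k,i}=z_{k+1,i}$ for $i\notin\{k,k-1,k-2,k-3\}$, and (A1) if $z_{k+1,k}<a_k$, $z_{k+1,k-1}>a_{k-1}$ and $z_{k+1,k-2}=0$, then $(z_{k,k},z_{k,k-1},z_{k,k-2},z_{k,k-3})=(z_{k+1,k}+1,\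 z_{k+1,k-1}-(a_{k-1}+1),\ a_{k-2}-1,\ z_{k+1,k-3}+1)$; (A2) if $z_{k+1,k}<a_k$, $a_{k-1}\le z_{k+1,k-1}\le 2a_{k-1}$ and $z_{k+1,k-2}>0$, then $(z_{k,k},z_{k,k-1},z_{k,k-2},z_{k,k-3})=(z_{k+1,k}+1,\ z_{k+1,k-1}-a_{k-1},\ z_{k+1,k-2}-1,\ z_{k+1,k-3})$; (A3) otherwise these four entries are unchanged from $z_{k+1}$. For $k=3$: $z_{3,i}=z_{4,i}$ for $i\notin\{1,2,3\}$, and (B1) if $z_{4,3}<a_3$, $z_{4,2}>a_2$, $z_{4,1}=0$: $(z_{3,3},z_{3,2},z_{3,1})=(z_{4,3}+1,\ z_{4,2}-(a_2+1),\ a_1-1)$; (B2) if $z_{4,3}<a_3$, $z_{4,2}\ge a_2$, $a_1\ge z_{4,1}>0$: $(z_{4,3}+1,\ z_{4,2}-a_2,\ z_{4,1}-1)$; (B3) if $z_{4,3}<a_3$, $z_{4,2}\ge a_2$, $z_{4,1}>a_1$: $(z_{4,3}+1,\ z_{4,2}-a_2+1,\ z_{4,1}-a_1-1)$; (B4) if $z_{4,2}<a_2$, $z_{4,1}\ge a_1$: $(z_{4,3},\ z_{4,2}+1,\ z_{4,1}-a_1)$; (B5) otherwise unchanged. -}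

module Defs where

open import Data.Nat using (ℕ; zero; suc; _+_; _*_; _∸_; _≤_; _<_; _<ᵇ_; _≡ᵇ_)
open import Data.Bool using (Bool; true; false; if_then_else_; _∧_; not)
open import Data.Product using (_×_)
open import Relation.Binary.PropositionalEquality using (_≡_)

-- Partial quotients a i (i ≥ 1) of the continued fraction are given as a sequence
-- a : ℕ → ℕ (a 0 is irrelevant here).  Words are functions ℕ → ℕ, position i ↦ entry u_i.

-- qq j = q_{j-1}; so qq 0 = q_{-1} = 0, qq 1 = q_0 = 1,
-- q_{k+1} = a_{k+1} q_k + q_{k-1}.
qq : (ℕ → ℕ) → ℕ → ℕ
qq a zero = 0
qq a (suc zero) = 1
qq a (suc (suc k)) = a (suc k) * qq a (suc k) + qq a k

-- value of the word b_n … b_1 : Σ_{k=0}^{n-1} b_{k+1} q_k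
ostValue : (ℕ → ℕ) → ℕ → (ℕ → ℕ) → ℕ
ostValue a zero b = 0
ostValue a (suc n) b = ostValue a n b + b (suc n) * qq a (suc n)

record IsOstrowskiRep (a : ℕ → ℕ) (n : ℕ) (b : ℕ → ℕ) (N : ℕ) : Set where
  field
    value   : N ≡ ostValue a n b
    first   : 1 ≤ n → b 1 < a 1
    bounded : ∀ i → 1 ≤ i → i ≤ n → b i ≤ a i
    zeroAft : ∀ i → 2 ≤ i → i ≤ n → b i ≡ a i → b (i ∸ 1) ≡ 0

-- s_i = x_i + y_i for 1 ≤ i ≤ n, and 0 otherwise (in particular s_m = 0, m = n+1)
sumWord : ℕ → (ℕ → ℕ) → (ℕ → ℕ) → ℕ → ℕ
sumWord n x y i = if (0 <ᵇ i) ∧ (i <ᵇ suc n) then x i + y i else 0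

infix 4 _≤ᵇ_
_≤ᵇ_ : ℕ → ℕ → Bool
m ≤ᵇ n = m <ᵇ suc n

-- replace entries at positions p0,p1,p2,p3 (used with distinct positions)
upd4 : (ℕ → ℕ) → ℕ → ℕ → ℕ → ℕ → ℕ → ℕ → ℕ → ℕ → ℕ → ℕ
upd4 z p0 p1 p2 p3 v0 v1 v2 v3 i =
  if i ≡ᵇ p0 then v0 else
  if i ≡ᵇ p1 then v1 else
  if i ≡ᵇ p2 then v2 else
  if i ≡ᵇ p3 then v3 else z i

upd3 : (ℕ → ℕ) → ℕ → ℕ → ℕ → ℕ → ℕ → ℕ → ℕ → ℕ
upd3 z p0 p1 p2 v0 v1 v2 i =
  if i ≡ᵇ p0 then v0 else
  if i ≡ᵇ p1 then v1 else
  if i ≡ᵇ p2 then v2 else z i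

-- step of Algorithm 1 for 4 ≤ k ≤ m : z_{k+1} ↦ z_k
step4 : (ℕ → ℕ) → ℕ → (ℕ → ℕ) → ℕ → ℕ
step4 a k z =
  if (z k <ᵇ a k) ∧ (a (k ∸ 1) <ᵇ z (k ∸ 1)) ∧ (z (k ∸ 2) ≡ᵇ 0)
  then upd4 z k (k ∸ 1) (k ∸ 2) (k ∸ 3)
            (z k + 1) (z (k ∸ 1) ∸ (a (k ∸ 1) + 1)) (a (k ∸ 2) ∸ 1) (z (k ∸ 3) + 1)
  else if (z k <ᵇ a k) ∧ (a (k ∸ 1) ≤ᵇ z (k ∸ 1)) ∧ (z (k ∸ 1) ≤ᵇ 2 * a (k ∸ 1)) ∧ (0 <ᵇ z (k ∸ 2))
  then upd4 z k (k ∸ 1) (k ∸ 2) (k ∸ 3)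
            (z k + 1) (z (k ∸ 1) ∸ a (k ∸ 1)) (z (k ∸ 2) ∸ 1) (z (k ∸ 3))
  else z

-- step of Algorithm 1 for k = 3 : z_4 ↦ z_3
step3 : (ℕ → ℕ) → (ℕ → ℕ) → ℕ → ℕ
step3 a z =
  if (z 3 <ᵇ a 3) ∧ (a 2 <ᵇ z 2) ∧ (z 1 ≡ᵇ 0)
  then upd3 z 3 2 1 (z 3 + 1) (z 2 ∸ (a 2 + 1)) (a 1 ∸ 1)
  else if (z 3 <ᵇ a 3) ∧ (a 2 ≤ᵇ z 2) ∧ (z 1 ≤ᵇ a 1) ∧ (0 <ᵇ z 1)
  then upd3 z 3 2 1 (z 3 + 1) (z 2 ∸ a 2) (z 1 ∸ 1)
  else if (z 3 <ᵇ a 3) ∧ (a 2 ≤ᵇ z 2) ∧ (a 1 <ᵇ z 1)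
  then upd3 z 3 2 1 (z 3 + 1) ((z 2 ∸ a 2) + 1) (z 1 ∸ a 1 ∸ 1)
  else if (z 2 <ᵇ a 2) ∧ (a 1 ≤ᵇ z 1)
  then upd3 z 3 2 1 (z 3) (z 2 + 1) (z 1 ∸ a 1)
  else z

stepAt : (ℕ → ℕ) → ℕ → (ℕ → ℕ) → ℕ → ℕ
stepAt a k z = if 4 ≤ᵇ k then step4 a k z else if k ≡ᵇ 3 then step3 a z else z

-- zFrom a m s d = z_{m+1-d}
zFrom : (ℕ → ℕ) → ℕ → (ℕ → ℕ) → ℕ → ℕ → ℕ
zFrom a m s zero = s
zFrom a m s (suc d) = stepAt a (m ∸ d) (zFrom a m s d)

-- algZ a m s k = z_k (meaningful for 3 ≤ k ≤ m+1), z_{k,i} = algZ a m s k i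
algZ : (ℕ → ℕ) → ℕ → (ℕ → ℕ) → ℕ → ℕ → ℕ
algZ a m s k = zFrom a m s (suc m ∸ k)

module Submission where

-- Write k = 3 + t, so that positions k−1 and k−2 are
-- 2 + t and 1 + t.  The step of Algorithm 1 at index j only changes the
-- entries at positions j, j−1, j−2, j−3, and raises the entry at j−3 by at
-- most one.  Following the steps m, m−1, …, k+1 that produce z_{k+1} from s,
-- this gives a locality invariant: z_{k+1} agrees with s at positions ≤ k−3,
-- and either z_{k+1,k−1} = a_{k−1} − 1 (rule A1 fired at index k+1), or
-- z_{k+1,k−1} ≤ s_{k−1} + 1 and z_{k+1,k−2} ≤ s_{k−2}.
-- The first alternative is incompatible with z_{k+1,k−1} ≥ 2a_{k−1}.  In the
-- second, s_{k−1} = x_{k−1} + y_{k−1} ≥ 2a_{k−1} − 1 with both digits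
-- ≤ a_{k−1}, so at least one digit is maximal, and the Ostrowski condition
-- forces the digit below it to vanish; this bounds s_{k−2} and hence z_{k+1,k−2}.

open import Defs
open import Data.Nat using (ℕ; suc; _+_; _*_; _∸_; _≤_)
open import Data.Product using (_×_)
open import Relation.Binary.PropositionalEquality using (_≡_)

open import Data.Nat using (zero; _<_; _<ᵇ_; _≡ᵇ_; z≤n; s≤s)
open import Data.Nat.Properties
open import Data.Bool using (Bool; true; false; if_then_else_; T; _∧_)
open import Data.Unit using (tt)
open import Data.Product using (_,_)
open import Data.Sum using (_⊎_; inj₁; inj₂)
open import Data.Empty using (⊥-elim)
open import Relation.Nullary using (¬_; yes; no; contradiction)
open import Relation.Binary.PropositionalEquality using (_≢_; refl; sym; trans; cong; subst)

if-true : ∀ {A : Set} {b : Bool} {x y : A} → T b → (if b then x else y) ≡ x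
if-true {b = true} _ = refl

if-false : ∀ {A : Set} {b : Bool} {x y : A} → ¬ T b → (if b then x else y) ≡ y
if-false {b = false} _ = refl
if-false {b = true} ¬b = ⊥-elim (¬b tt)

if-cases : ∀ {A : Set} (P : A → Set) (b : Bool) {x y : A} → P x → P y → P (if b then x else y)
if-cases P true px py = px
if-cases P false px py = py

≢⇒¬≡ᵇ : ∀ {i p} → i ≢ p → ¬ T (i ≡ᵇ p)
≢⇒¬≡ᵇ {i} {p} i≢p t = i≢p (≡ᵇ⇒≡ i p t)

module _ (z : ℕ → ℕ) (p₀ p₁ p₂ p₃ v₀ v₁ v₂ v₃ : ℕ) where

  upd4-other : ∀ i → i ≢ p₀ → i ≢ p₁ → i ≢ p₂ → i ≢ p₃ →
               upd4 z p₀ p₁ p₂ p₃ v₀ v₁ v₂ v₃ i ≡ z i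
  upd4-other i n₀ n₁ n₂ n₃ =
    trans (if-false (≢⇒¬≡ᵇ n₀)) (trans (if-false (≢⇒¬≡ᵇ n₁))
      (trans (if-false (≢⇒¬≡ᵇ n₂)) (if-false (≢⇒¬≡ᵇ n₃))))

  upd4-at₂ : p₂ ≢ p₀ → p₂ ≢ p₁ → upd4 z p₀ p₁ p₂ p₃ v₀ v₁ v₂ v₃ p₂ ≡ v₂
  upd4-at₂ n₀ n₁ =
    trans (if-false (≢⇒¬≡ᵇ n₀)) (trans (if-false (≢⇒¬≡ᵇ n₁)) (if-true (≡⇒≡ᵇ p₂ p₂ refl)))

  upd4-at₃ : p₃ ≢ p₀ → p₃ ≢ p₁ → p₃ ≢ p₂ → upd4 z p₀ p₁ p₂ p₃ v₀ v₁ v₂ v₃ p₃ ≡ v₃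
  upd4-at₃ n₀ n₁ n₂ =
    trans (if-false (≢⇒¬≡ᵇ n₀)) (trans (if-false (≢⇒¬≡ᵇ n₁))
      (trans (if-false (≢⇒¬≡ᵇ n₂)) (if-true (≡⇒≡ᵇ p₃ p₃ refl))))

module _ (a : ℕ → ℕ) (k : ℕ) (z : ℕ → ℕ) where

  A1-word : ℕ → ℕ
  A1-word = upd4 z k (k ∸ 1) (k ∸ 2) (k ∸ 3)
                 (z k + 1) (z (k ∸ 1) ∸ (a (k ∸ 1) + 1)) (a (k ∸ 2) ∸ 1) (z (k ∸ 3) + 1)

  A2-word : ℕ → ℕ
  A2-word = upd4 z k (k ∸ 1) (k ∸ 2) (k ∸ 3)
                 (z k + 1) (z (k ∸ 1) ∸ a (k ∸ 1)) (z (k ∸ 2) ∸ 1) (z (k ∸ 3))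

  A1-test : Bool
  A1-test = (z k <ᵇ a k) ∧ (a (k ∸ 1) <ᵇ z (k ∸ 1)) ∧ (z (k ∸ 2) ≡ᵇ 0)

  A2-test : Bool
  A2-test = (z k <ᵇ a k) ∧ (a (k ∸ 1) ≤ᵇ z (k ∸ 1)) ∧ (z (k ∸ 1) ≤ᵇ 2 * a (k ∸ 1))
            ∧ (0 <ᵇ z (k ∸ 2))

  step4-cases : step4 a k z ≡ A1-word ⊎ step4 a k z ≡ A2-word ⊎ step4 a k z ≡ z
  step4-cases =
    if-cases P A1-test (inj₁ refl) (if-cases P A2-test (inj₂ (inj₁ refl)) (inj₂ (inj₂ refl)))
    where
    P : (ℕ → ℕ) → Set
    P w = w ≡ A1-word ⊎ w ≡ A2-word ⊎ w ≡ z

module _ (z : ℕ → ℕ) (t v₀ v₁ v₂ v₃ : ℕ) where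

  window-below : ∀ i → i < suc t → upd4 z (4 + t) (3 + t) (2 + t) (1 + t) v₀ v₁ v₂ v₃ i ≡ z i
  window-below i i<1+t = upd4-other z (4 + t) (3 + t) (2 + t) (1 + t) v₀ v₁ v₂ v₃ i
                           (below 3) (below 2) (below 1) (below 0)
    where
    below : ∀ r → i ≢ r + suc t
    below r = <⇒≢ (≤-trans i<1+t (m≤n+m (suc t) r))

  window-k−2 : upd4 z (4 + t) (3 + t) (2 + t) (1 + t) v₀ v₁ v₂ v₃ (2 + t) ≡ v₂
  window-k−2 = upd4-at₂ z (4 + t) (3 + t) (2 + t) (1 + t) v₀ v₁ v₂ v₃ (λ ()) (λ ())

  window-k−3 : upd4 z (4 + t) (3 + t) (2 + t) (1 + t) v₀ v₁ v₂ v₃ (1 + t) ≡ v₃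
  window-k−3 = upd4-at₃ z (4 + t) (3 + t) (2 + t) (1 + t) v₀ v₁ v₂ v₃ (λ ()) (λ ()) (λ ())

module _ (a z : ℕ → ℕ) (t : ℕ) where

  step4-below : ∀ i → i < suc t → step4 a (4 + t) z i ≡ z i
  step4-below i i<1+t with step4-cases a (4 + t) z
  ... | inj₁ A1 rewrite A1 = window-below z t _ _ _ _ i i<1+t
  ... | inj₂ (inj₁ A2) rewrite A2 = window-below z t _ _ _ _ i i<1+t
  ... | inj₂ (inj₂ A3) rewrite A3 = refl

  step4-k−3 : step4 a (4 + t) z (1 + t) ≤ z (1 + t) + 1
  step4-k−3 with step4-cases a (4 + t) z
  ... | inj₁ A1 rewrite A1 = ≤-reflexive (window-k−3 z t _ _ _ _)
  ... | inj₂ (inj₁ A2) rewrite A2 = ≤-trans (≤-reflexive (window-k−3 z t _ _ _ _)) (m≤m+n _ 1)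
  ... | inj₂ (inj₂ A3) rewrite A3 = m≤m+n _ 1

  step4-k−2 : step4 a (4 + t) z (2 + t) ≡ a (2 + t) ∸ 1
            ⊎ (step4 a (4 + t) z (2 + t) ≤ z (2 + t) × step4 a (4 + t) z (1 + t) ≤ z (1 + t))
  step4-k−2 with step4-cases a (4 + t) z
  ... | inj₁ A1 rewrite A1 = inj₁ (window-k−2 z t _ _ _ _)
  ... | inj₂ (inj₁ A2) rewrite A2 =
    inj₂ ( ≤-trans (≤-reflexive (window-k−2 z t _ _ _ _)) (m∸n≤m _ 1)
         , ≤-reflexive (window-k−3 z t _ _ _ _))
  ... | inj₂ (inj₂ A3) rewrite A3 = inj₂ (≤-refl , ≤-refl)

-- The run of Algorithm 1 on a word s of length m.  zFrom a m s d is z_{j+1}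
-- when d + j = m; it is obtained from z_{j+2} by the step at index j + 1.

module Run (a : ℕ → ℕ) (m : ℕ) (s : ℕ → ℕ) where

  Z : ℕ → ℕ → ℕ
  Z = zFrom a m s

  Z-suc : ∀ e j → suc e + j ≡ m → Z (suc e) ≡ stepAt a (suc j) (Z e)
  Z-suc e j refl = cong (λ k → stepAt a k (Z e)) index
    where
    index : suc e + j ∸ e ≡ suc j
    index = trans (cong (_∸ e) (sym (+-suc e j))) (m+n∸m≡n e (suc j))

  Z-below : ∀ d t i → d + (3 + t) ≡ m → i ≤ t → Z d i ≡ s i
  Z-below zero t i eq i≤t = refl
  Z-below (suc e) t i eq i≤t rewrite Z-suc e (3 + t) eq =
    trans (step4-below a (Z e) t i (s≤s i≤t))
          (Z-below e (suc t) i (trans (+-suc e (3 + t)) eq) (≤-trans i≤t (n≤1+n t)))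

  Z-k−2 : ∀ d t → d + (3 + t) ≡ m → Z d (1 + t) ≤ s (1 + t) + 1
  Z-k−2 zero t eq = m≤m+n _ 1
  Z-k−2 (suc e) t eq rewrite Z-suc e (3 + t) eq =
    ≤-trans (step4-k−3 a (Z e) t)
      (≤-reflexive (cong (_+ 1) (Z-below e (suc t) (1 + t) (trans (+-suc e (3 + t)) eq) ≤-refl)))

  Z-k−1 : ∀ d t → d + (3 + t) ≡ m →
          Z d (2 + t) ≡ a (2 + t) ∸ 1
        ⊎ (Z d (2 + t) ≤ s (2 + t) + 1 × Z d (1 + t) ≤ s (1 + t))
  Z-k−1 zero t eq = inj₂ (m≤m+n _ 1 , ≤-refl)
  Z-k−1 (suc e) t eq rewrite Z-suc e (3 + t) eq with step4-k−2 a (Z e) t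
  ... | inj₁ reset = inj₁ reset
  ... | inj₂ (le₂ , le₁) =
    inj₂ ( ≤-trans le₂ (Z-k−2 e (suc t) eq′)
         , ≤-trans le₁ (≤-reflexive (Z-below e (suc t) (1 + t) eq′ ≤-refl)))
    where
    eq′ : e + (3 + suc t) ≡ m
    eq′ = trans (+-suc e (3 + t)) eq

double : ∀ c → 2 * c ≡ c + c
double c = cong (c +_) (+-identityʳ c)

both-maximal : ∀ {x y c} → x ≤ c → y ≤ c → 2 * c ≤ x + y → x ≡ c × y ≡ c
both-maximal {x} {y} {c} x≤c y≤c le =
  first x≤c y≤c le , first y≤c x≤c (subst (2 * c ≤_) (+-comm x y) le)
  where
  first : ∀ {u v} → u ≤ c → v ≤ c → 2 * c ≤ u + v → u ≡ c
  first {u} {v} u≤c v≤c le′ with u ≟ c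
  ... | yes u≡c = u≡c
  ... | no u≢c = contradiction le′ (<⇒≱ (begin-strict
      u + v <⟨ +-mono-<-≤ (≤∧≢⇒< u≤c u≢c) v≤c ⟩
      c + c ≡⟨ double c ⟨
      2 * c ∎))
    where open ≤-Reasoning

one-maximal : ∀ {x y c} → x ≤ c → y ≤ c → 2 * c ≤ x + y + 1 → x ≡ c ⊎ y ≡ c
one-maximal {x} {y} {c} x≤c y≤c le with x ≟ c | y ≟ c
... | yes x≡c | _ = inj₁ x≡c
... | no _ | yes y≡c = inj₂ y≡c
... | no x≢c | no y≢c = contradiction le (<⇒≱ (begin-strict
    x + y + 1   ≡⟨ +-assoc x y 1 ⟩
    x + (y + 1) ≡⟨ cong (x +_) (+-comm y 1) ⟩
    x + suc y   <⟨ n<1+n (x + suc y) ⟩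
    suc x + suc y ≤⟨ +-mono-≤ (≤∧≢⇒< x≤c x≢c) (≤∧≢⇒< y≤c y≢c) ⟩
    c + c       ≡⟨ double c ⟨
    2 * c ∎))
  where open ≤-Reasoning

pred≢double+ : ∀ c b → 1 ≤ c → c ∸ 1 ≢ 2 * c + b
pred≢double+ (suc c) b _ = <⇒≢ (≤-trans (m≤m+n (suc c) (suc c + 0)) (m≤m+n _ b))

module Digits (a : ℕ → ℕ) (n M N : ℕ) (x y : ℕ → ℕ)
              (rx : IsOstrowskiRep a n x M) (ry : IsOstrowskiRep a n y N) where
  open IsOstrowskiRep

  below-saturated : ∀ j → 2 + j ≤ n → 2 * a (2 + j) ≤ x (2 + j) + y (2 + j) →
                    x (1 + j) + y (1 + j) ≡ 0
  below-saturated j le sat with both-maximal (bounded rx (2 + j) (s≤s z≤n) le)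
                                             (bounded ry (2 + j) (s≤s z≤n) le) sat
  ... | x≡a , y≡a
    rewrite zeroAft rx (2 + j) (s≤s (s≤s z≤n)) le x≡a
          | zeroAft ry (2 + j) (s≤s (s≤s z≤n)) le y≡a = refl

  below-nearly-saturated : ∀ j → 2 + j ≤ n → 2 * a (2 + j) ≤ x (2 + j) + y (2 + j) + 1 →
                           x (1 + j) + y (1 + j) ≤ a (1 + j)
  below-nearly-saturated j le sat
    with one-maximal (bounded rx (2 + j) (s≤s z≤n) le) (bounded ry (2 + j) (s≤s z≤n) le) sat
  ... | inj₁ x≡a rewrite zeroAft rx (2 + j) (s≤s (s≤s z≤n)) le x≡a =
    bounded ry (1 + j) (s≤s z≤n) (≤-trans (n≤1+n _) le)
  ... | inj₂ y≡a rewrite zeroAft ry (2 + j) (s≤s (s≤s z≤n)) le y≡a | +-identityʳ (x (1 + j)) =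
    bounded rx (1 + j) (s≤s z≤n) (≤-trans (n≤1+n _) le)

sumWord-inside : ∀ n (x y : ℕ → ℕ) j → suc j ≤ n → sumWord n x y (suc j) ≡ x (suc j) + y (suc j)
sumWord-inside n x y j le = if-true (<⇒<ᵇ (s≤s le))

-- On the sum word s of two representations of length n (so m = n + 1), a
-- value z_{k+1,k−1} = 2a_{k−1} + b rules out the reset by A1 (as a_{k−1} ≥ 1),
-- so the invariant bounds both entries by the digit sums.
module SumRun (a : ℕ → ℕ) (n : ℕ) (x y : ℕ → ℕ) where
  open Run a (suc n) (sumWord n x y)

  large-k−1 : ∀ t → 1 ≤ a (2 + t) → 3 + t ≤ suc n → ∀ b →
              Z (suc n ∸ (3 + t)) (2 + t) ≡ 2 * a (2 + t) + b →
              2 * a (2 + t) + b ≤ x (2 + t) + y (2 + t) + 1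
            × Z (suc n ∸ (3 + t)) (1 + t) ≤ x (1 + t) + y (1 + t)
  large-k−1 t a≥1 k≤m@(s≤s 2+t≤n) b h with Z-k−1 (suc n ∸ (3 + t)) t (m∸n+n≡m k≤m)
  ... | inj₁ reset = ⊥-elim (pred≢double+ _ b a≥1 (trans (sym reset) h))
  ... | inj₂ (le₂ , le₁) =
    ( (begin
        2 * a (2 + t) + b            ≡⟨ h ⟨
        Z (suc n ∸ (3 + t)) (2 + t)  ≤⟨ le₂ ⟩
        sumWord n x y (2 + t) + 1    ≡⟨ cong (_+ 1) (sumWord-inside n x y (suc t) 2+t≤n) ⟩
        x (2 + t) + y (2 + t) + 1    ∎)
    , ≤-trans le₁ (≤-reflexive (sumWord-inside n x y t (≤-trans (n≤1+n _) 2+t≤n))))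
    where open ≤-Reasoning

mainTheorem5 : (a : ℕ → ℕ) → (∀ i → 1 ≤ i → 1 ≤ a i) →
    (n M N : ℕ) (x y : ℕ → ℕ) →
    IsOstrowskiRep a n x M → IsOstrowskiRep a n y N →
    ∀ k → 3 ≤ k → k ≤ suc n →
      (algZ a (suc n) (sumWord n x y) (suc k) (k ∸ 1) ≡ 2 * a (k ∸ 1) + 1 →
        algZ a (suc n) (sumWord n x y) (suc k) (k ∸ 2) ≡ 0)
      × (algZ a (suc n) (sumWord n x y) (suc k) (k ∸ 1) ≡ 2 * a (k ∸ 1) →
        algZ a (suc n) (sumWord n x y) (suc k) (k ∸ 2) ≤ a (k ∸ 2))
mainTheorem5 a a≥1 n M N x y rx ry (suc (suc (suc t))) (s≤s (s≤s (s≤s _))) k≤m@(s≤s 2+t≤n) =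
  part-i , part-ii
  where
  open Run a (suc n) (sumWord n x y) using (Z)
  open SumRun a n x y
  open Digits a n M N x y rx ry
  d = suc n ∸ (3 + t)
  large = large-k−1 t (a≥1 (2 + t) (s≤s z≤n)) k≤m
  part-i : Z d (2 + t) ≡ 2 * a (2 + t) + 1 → Z d (1 + t) ≡ 0
  part-i h with large 1 h
  ... | le₂ , le₁ =
    n≤0⇒n≡0 (≤-trans le₁ (≤-reflexive (below-saturated t 2+t≤n (+-cancelʳ-≤ 1 _ _ le₂))))
  part-ii : Z d (2 + t) ≡ 2 * a (2 + t) → Z d (1 + t) ≤ a (1 + t)
  part-ii h with large 0 (trans h (sym (+-identityʳ _)))
  ... | le₂ , le₁ = ≤-trans le₁ (below-nearly-saturated t 2+t≤n
      (subst (_≤ x (2 + t) + y (2 + t) + 1) (+-identityʳ (2 * a (2 + t))) le₂))
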